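{- Let $n\ge 3$ and consider a partial coloring of an $n\times n$ square $A$ with colors from $\{1,2,\dots,2n-2\}$. If this partial coloring uniquely extends to $L(n,2n-2)$, then there are no indices $r,c$ such that the five entries $(r,c),(r,c+1),(r+1,c+1),(r+1,c+2),(r+2,c+2)$ are all uncolored, and no indices $r,c$ such that the five entries $(r,c),(r+1,c),(r+1,c+1),(r+2,c+1),(r+2,c+2)$ are all uncolored.
   Context: Entry $(i,j)$ is the entry in row $i$ and column $j$ (indices in $\{1,\dots,n\}$). An $L(n,k)$ is an $n\times n$ square all of whose entries are colored with colors from a set of $k$ colors so that all entries in a common row, and all entries in a common column, have pairwise different colors. A partial coloring assigns colors to some entries; the others are uncolored. It uniquely extends to $L(n,k)$ if there is exactly one way to color the uncolored entries so that the resulting fully colored square is an $L(n,k)$. -}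

module Defs where

open import Data.Nat using (ℕ; _<_)
open import Data.Fin using (Fin; fromℕ<)
open import Data.Maybe using (Maybe; just; nothing)
open import Data.Product using (Σ; _×_; ∃)
open import Relation.Binary.PropositionalEquality using (_≡_)

Coloring : ℕ → ℕ → Set
Coloring n k = Fin n → Fin n → Fin k

IsL : (n k : ℕ) → Coloring n k → Set
IsL n k L =
  (∀ i j j' → L i j ≡ L i j' → j ≡ j') ×
  (∀ i i' j → L i j ≡ L i' j → i ≡ i')

-- A partial coloring: nothing = uncolored entry.
PartialColoring : ℕ → ℕ → Set
PartialColoring n k = Fin n → Fin n → Maybe (Fin k)

Extends : {n k : ℕ} → PartialColoring n k → Coloring n k → Set
Extends {n} {k} P L = ∀ i j (x : Fin k) → P i j ≡ just x → L i j ≡ x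

UniquelyExtends : (n k : ℕ) → PartialColoring n k → Set
UniquelyExtends n k P =
  Σ (Coloring n k) λ L → (IsL n k L × Extends P L) ×
    (∀ L' → IsL n k L' → Extends P L' → ∀ i j → L' i j ≡ L i j)

Uncolored : {n k : ℕ} → PartialColoring n k → (i j : ℕ) → i < n → j < n → Set
Uncolored P i j p q = P (fromℕ< p) (fromℕ< q) ≡ nothing

module Submission where

-- Let L be the unique extension. Recolouring an uncoloured entry (i,j), or exchanging the
-- colours of two uncoloured entries in a common row or column, must not give another L(n,2n-2).
-- Hence row i and column j together contain all 2n - 2 colours, so they share at most one colour
-- besides L i j, its partner; and of two uncoloured entries in a common row, one has its colour
-- in the column of the other. Around a staircase of five uncoloured entries, the colour of each
-- coloured entry of the 3 × 3 block must be a partner at one of the five (entry (2,0) may instead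
-- equal the central entry), and with the four exchange conditions there are too few partners to
-- go round. The other shape is the transpose of the staircase.

open import Defs
open import Data.Empty using (⊥; ⊥-elim)
open import Data.Fin using (Fin; zero; suc; fromℕ<; toℕ; splitAt; join)
open import Data.Fin.Permutation.Components using (transpose; transpose-inverse)
open import Data.Fin.Properties
  using (_≟_; any?; injective⇒≤; splitAt-join; join-splitAt; toℕ-fromℕ<)
open import Data.Maybe using (just; nothing)
open import Data.Nat using (ℕ; _+_; _∸_; _*_; _≤_; _<_)
open import Data.Nat.Properties
  using (+-identityʳ; +-comm; +-cancelˡ-≡; m+1+n≢m; m≤n+m∸n; n<1+n; <⇒≱; module ≤-Reasoning)
open import Data.Product using (∃; _×_; _,_; proj₁; proj₂)
open import Data.Sum using (_⊎_; inj₁; inj₂; [_,_]′) renaming (map to ⊎-map; swap to ⊎-swap)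
open import Data.Vec.Functional using (updateAt)
open import Data.Vec.Functional.Properties using (updateAt-updates; updateAt-minimal)
open import Function using (_∘_; id; const; flip)
open import Relation.Nullary using (¬_; Dec; yes; no; contradiction)
open import Relation.Binary.PropositionalEquality
  using (_≡_; _≢_; refl; sym; trans; cong; cong-app; subst; ≢-sym)

updateAt-const-cases : ∀ {A : Set} {m} (f : Fin m → A) i₀ (a : A) i →
  (i ≡ i₀ × updateAt f i₀ (const a) i ≡ a) ⊎ (i ≢ i₀ × updateAt f i₀ (const a) i ≡ f i)
updateAt-const-cases f i₀ a i with i ≟ i₀
... | yes refl = inj₁ (refl , updateAt-updates i₀ f)
... | no i≢i₀  = inj₂ (i≢i₀ , updateAt-minimal i i₀ f i≢i₀)

transpose-matchˡ : ∀ {m} (i j : Fin m) → transpose i j i ≡ j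
transpose-matchˡ i j with i ≟ i
... | yes _  = refl
... | no i≢i = contradiction refl i≢i

transpose-cases : ∀ {m} (i j k : Fin m) →
  (k ≡ i × transpose i j k ≡ j) ⊎ (k ≡ j × transpose i j k ≡ i) ⊎ transpose i j k ≡ k
transpose-cases i j k with k ≟ i
... | yes k≡i = inj₁ (k≡i , refl)
... | no _ with k ≟ j
...   | yes k≡j = inj₂ (inj₁ (k≡j , refl))
...   | no _    = inj₂ (inj₂ refl)

transpose-injective : ∀ {m} (i j : Fin m) {k k′} → transpose i j k ≡ transpose i j k′ → k ≡ k′
transpose-injective i j eq =
  trans (sym (transpose-inverse j i)) (trans (cong (transpose j i) eq) (transpose-inverse j i))

⊎-injective⇒≤ : ∀ {a b c d} {h : Fin a ⊎ Fin b → Fin c ⊎ Fin d} →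
  (∀ {u v} → h u ≡ h v → u ≡ v) → a + b ≤ c + d
⊎-injective⇒≤ {a} {b} {c} {d} {h} h-injective = injective⇒≤ {f = join c d ∘ h ∘ splitAt a} λ {x} {y} eq →
  trans (sym (join-splitAt a b x))
    (trans (cong (join a b) (h-injective
             (trans (sym (splitAt-join c d _)) (trans (cong (splitAt c) eq) (splitAt-join c d _)))))
      (join-splitAt a b y))

fromℕ<-≢ : ∀ {m m′ n} (p : m < n) (q : m′ < n) → m ≢ m′ → fromℕ< p ≢ fromℕ< q
fromℕ<-≢ p q m≢m′ eq = m≢m′ (trans (sym (toℕ-fromℕ< p)) (trans (cong toℕ eq) (toℕ-fromℕ< q)))

Distinct₃ : ∀ {n} → Fin n → Fin n → Fin n → Set
Distinct₃ x y z = x ≢ y × x ≢ z × y ≢ z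

consecutive-distinct : ∀ {n} r (p₀ : r < n) (p₁ : r + 1 < n) (p₂ : r + 2 < n) →
  Distinct₃ (fromℕ< p₀) (fromℕ< p₁) (fromℕ< p₂)
consecutive-distinct r p₀ p₁ p₂ =
  fromℕ<-≢ p₀ p₁ (≢-sym (m+1+n≢m r)) ,
  fromℕ<-≢ p₀ p₂ (≢-sym (m+1+n≢m r)) ,
  fromℕ<-≢ p₁ p₂ ((λ ()) ∘ +-cancelˡ-≡ r 1 2)

n+n<2n∸2+3 : ∀ n → n + n < 2 * n ∸ 2 + 3
n+n<2n∸2+3 n = begin-strict
  n + n            ≡⟨ cong (n +_) (sym (+-identityʳ n)) ⟩
  2 * n            ≤⟨ m≤n+m∸n (2 * n) 2 ⟩
  2 + (2 * n ∸ 2)  <⟨ n<1+n _ ⟩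
  3 + (2 * n ∸ 2)  ≡⟨ +-comm 3 (2 * n ∸ 2) ⟩
  2 * n ∸ 2 + 3    ∎
  where open ≤-Reasoning

module _ {n k : ℕ} where

  InRow : Coloring n k → Fin n → Fin k → Set
  InRow L i x = ∃ λ j → L i j ≡ x

  InCol : Coloring n k → Fin n → Fin k → Set
  InCol L j x = ∃ λ i → L i j ≡ x

  inRow? : ∀ L i x → Dec (InRow L i x)
  inRow? L i x = any? λ j → L i j ≟ x

  inCol? : ∀ L j x → Dec (InCol L j x)
  inCol? L j x = any? λ i → L i j ≟ x

  Partner : Coloring n k → Fin n → Fin n → Fin k → Set
  Partner L i j x = InRow L i x × InCol L j x × x ≢ L i j

  partner-flip : ∀ L {i j x} → Partner L i j x → Partner (flip L) j i x
  partner-flip _ (∈row , ∈col , x≢) = ∈col , ∈row , x≢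

  distinct-in-row : ∀ {L} → IsL n k L → ∀ {i j j′} → j ≢ j′ → L i j ≢ L i j′
  distinct-in-row latin j≢j′ = j≢j′ ∘ proj₁ latin _ _ _

  distinct-in-col : ∀ {L} → IsL n k L → ∀ {i i′ j} → i ≢ i′ → L i j ≢ L i′ j
  distinct-in-col latin i≢i′ = i≢i′ ∘ proj₂ latin _ _ _

  isL-flip : ∀ {L} → IsL n k L → IsL n k (flip L)
  isL-flip (rows , cols) = (λ j i i′ → cols i i′ j) , (λ j j′ i → rows i j j′)

  uniquelyExtends-flip : ∀ {P} → UniquelyExtends n k P → UniquelyExtends n k (flip P)
  uniquelyExtends-flip (L , (latin , extends) , unique) =
    flip L , (isL-flip latin , λ i j → extends j i) ,
    λ L′ latin′ extends′ i j → unique (flip L′) (isL-flip latin′) (λ i j → extends′ j i) j i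

module RowColumnPositions {n k} (L : Coloring n k) (i j : Fin n)
                          (cover : ∀ z → InRow L i z ⊎ InCol L j z) where

  locate : ∀ z → InRow L i z ⊎ (¬ InRow L i z × InCol L j z)
  locate z with inRow? L i z
  ... | yes ∈row = inj₁ ∈row
  ... | no ∉row  = inj₂ (∉row , [ flip contradiction ∉row , id ]′ (cover z))

  position : Fin k → Fin n ⊎ Fin n
  position = ⊎-map proj₁ (proj₁ ∘ proj₂) ∘ locate

  colourAt : Fin n ⊎ Fin n → Fin k
  colourAt (inj₁ j′) = L i j′
  colourAt (inj₂ i′) = L i′ j

  colourAt-position : ∀ z → colourAt (position z) ≡ z
  colourAt-position z with locate z
  ... | inj₁ (_ , at)       = at
  ... | inj₂ (_ , (_ , at)) = at

  position-inj₂ : ∀ z {i′} → position z ≡ inj₂ i′ → ¬ InRow L i z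
  position-inj₂ z eq with locate z
  ... | inj₂ (∉row , _) = ∉row

-- Row i and column j together contain all k colours, so they share at most
-- n + n - k < 3 colours, one of which is L i j.
at-most-one-partner : ∀ {n k} {L : Coloring n k} {i j} → n + n < k + 3 →
  (∀ z → InRow L i z ⊎ InCol L j z) →
  ∀ {x y} → Partner L i j x → Partner L i j y → x ≡ y
at-most-one-partner {n} {k} {L} {i} {j} n+n<k+3 cover {x} {y} (x∈row , (iₓ , x-at) , x≢) (y∈row , (i_y , y-at) , y≢)
  with x ≟ y
... | yes x≡y = x≡y
... | no x≢y  = contradiction (⊎-injective⇒≤ embed-injective) (<⇒≱ n+n<k+3)
  where
  open RowColumnPositions L i j cover

  common : Fin 3 → Fin k
  common zero             = L i j
  common (suc zero)       = x
  common (suc (suc zero)) = y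

  commonRow : Fin 3 → Fin n
  commonRow zero             = i
  commonRow (suc zero)       = iₓ
  commonRow (suc (suc zero)) = i_y

  commonRow-colour : ∀ t → L (commonRow t) j ≡ common t
  commonRow-colour zero             = refl
  commonRow-colour (suc zero)       = x-at
  commonRow-colour (suc (suc zero)) = y-at

  common-inRow : ∀ t → InRow L i (common t)
  common-inRow zero             = j , refl
  common-inRow (suc zero)       = x∈row
  common-inRow (suc (suc zero)) = y∈row

  common-injective : ∀ {s t} → common s ≡ common t → s ≡ t
  common-injective {zero}           {zero}           _  = refl
  common-injective {zero}           {suc zero}       eq = contradiction (sym eq) x≢
  common-injective {zero}           {suc (suc zero)} eq = contradiction (sym eq) y≢
  common-injective {suc zero}       {zero}           eq = contradiction eq x≢
  common-injective {suc zero}       {suc zero}       _  = refl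
  common-injective {suc zero}       {suc (suc zero)} eq = contradiction eq x≢y
  common-injective {suc (suc zero)} {zero}           eq = contradiction eq y≢
  common-injective {suc (suc zero)} {suc zero}       eq = contradiction (sym eq) x≢y
  common-injective {suc (suc zero)} {suc (suc zero)} _  = refl

  embed : Fin k ⊎ Fin 3 → Fin n ⊎ Fin n
  embed (inj₁ z) = position z
  embed (inj₂ t) = inj₂ (commonRow t)

  position≢commonRow : ∀ z t → position z ≢ inj₂ (commonRow t)
  position≢commonRow z t eq = position-inj₂ z eq
    (subst (InRow L i) (sym (trans (sym (colourAt-position z)) (trans (cong colourAt eq) (commonRow-colour t))))
           (common-inRow t))

  embed-injective : ∀ {u v} → embed u ≡ embed v → u ≡ v
  embed-injective {inj₁ z} {inj₁ z′} eq =
    cong inj₁ (trans (sym (colourAt-position z)) (trans (cong colourAt eq) (colourAt-position z′)))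
  embed-injective {inj₁ z} {inj₂ t}  eq = contradiction eq (position≢commonRow z t)
  embed-injective {inj₂ t} {inj₁ z}  eq = contradiction (sym eq) (position≢commonRow z t)
  embed-injective {inj₂ t} {inj₂ t′} eq =
    cong inj₂ (common-injective (trans (sym (commonRow-colour t)) (trans (cong colourAt eq) (commonRow-colour t′))))

module UniqueExtension {n k : ℕ} {P : PartialColoring n k} (U : UniquelyExtends n k P) where

  L : Coloring n k
  L = proj₁ U

  latin : IsL n k L
  latin = proj₁ (proj₁ (proj₂ U))

  extends : Extends P L
  extends = proj₂ (proj₁ (proj₂ U))

  unique : ∀ L′ → IsL n k L′ → Extends P L′ → ∀ i j → L′ i j ≡ L i j
  unique = proj₂ (proj₂ U)

  row-determined : ∀ i₀ (ρ : Fin n → Fin k) →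
    (∀ {j j′} → ρ j ≡ ρ j′ → j ≡ j′) →
    (∀ i j → i ≢ i₀ → L i j ≢ ρ j) →
    (∀ j x → P i₀ j ≡ just x → ρ j ≡ x) →
    ∀ j → ρ j ≡ L i₀ j
  row-determined i₀ ρ ρ-injective ρ-fresh ρ-extends j =
    trans (sym (cong-app (updateAt-updates i₀ L) j)) (unique L′ (rows , cols) extends′ i₀ j)
    where
    L′ : Coloring n k
    L′ = updateAt L i₀ (const ρ)

    rows : ∀ i j j′ → L′ i j ≡ L′ i j′ → j ≡ j′
    rows i j j′ eq with updateAt-const-cases L i₀ ρ i
    ... | inj₁ (_ , row) = ρ-injective (subst (λ r → r j ≡ r j′) row eq)
    ... | inj₂ (_ , row) = proj₁ latin i j j′ (subst (λ r → r j ≡ r j′) row eq)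

    cols : ∀ i i′ j → L′ i j ≡ L′ i′ j → i ≡ i′
    cols i i′ j eq with updateAt-const-cases L i₀ ρ i | updateAt-const-cases L i₀ ρ i′
    ... | inj₁ (i≡ , _)   | inj₁ (i′≡ , _)   = trans i≡ (sym i′≡)
    ... | inj₁ (_ , row)  | inj₂ (i′≢ , row′) =
      contradiction (trans (sym (cong-app row′ j)) (trans (sym eq) (cong-app row j))) (ρ-fresh i′ j i′≢)
    ... | inj₂ (i≢ , row) | inj₁ (_ , row′)   =
      contradiction (trans (sym (cong-app row j)) (trans eq (cong-app row′ j))) (ρ-fresh i j i≢)
    ... | inj₂ (_ , row)  | inj₂ (_ , row′)   =
      proj₂ latin i i′ j (trans (sym (cong-app row j)) (trans eq (cong-app row′ j)))

    extends′ : Extends P L′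
    extends′ i j x Pij≡x with updateAt-const-cases L i₀ ρ i
    ... | inj₁ (refl , row) = trans (cong-app row j) (ρ-extends j x Pij≡x)
    ... | inj₂ (_ , row)    = trans (cong-app row j) (extends i j x Pij≡x)

  cover : ∀ {i₀ j₀} → P i₀ j₀ ≡ nothing → ∀ x → InRow L i₀ x ⊎ InCol L j₀ x
  cover {i₀} {j₀} uncoloured x with inRow? L i₀ x | inCol? L j₀ x
  ... | yes ∈row | _       = inj₁ ∈row
  ... | no _     | yes ∈col = inj₂ ∈col
  ... | no ∉row  | no ∉col  = contradiction (j₀ , sym x≡L) ∉row
    where
    ρ : Fin n → Fin k
    ρ = updateAt (L i₀) j₀ (const x)

    ρ-injective : ∀ {j j′} → ρ j ≡ ρ j′ → j ≡ j′
    ρ-injective {j} {j′} eq with updateAt-const-cases (L i₀) j₀ x j | updateAt-const-cases (L i₀) j₀ x j′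
    ... | inj₁ (j≡ , _)  | inj₁ (j′≡ , _)  = trans j≡ (sym j′≡)
    ... | inj₁ (_ , at)  | inj₂ (_ , at′)  = contradiction (j′ , trans (sym at′) (trans (sym eq) at)) ∉row
    ... | inj₂ (_ , at)  | inj₁ (_ , at′)  = contradiction (j , trans (sym at) (trans eq at′)) ∉row
    ... | inj₂ (_ , at)  | inj₂ (_ , at′)  = proj₁ latin i₀ j j′ (trans (sym at) (trans eq at′))

    ρ-fresh : ∀ i j → i ≢ i₀ → L i j ≢ ρ j
    ρ-fresh i j i≢i₀ eq with updateAt-const-cases (L i₀) j₀ x j
    ... | inj₁ (refl , at) = ∉col (i , trans eq at)
    ... | inj₂ (_ , at)    = i≢i₀ (proj₂ latin i i₀ j (trans eq at))

    ρ-extends : ∀ j y → P i₀ j ≡ just y → ρ j ≡ y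
    ρ-extends j y Pi₀j≡y with updateAt-const-cases (L i₀) j₀ x j
    ... | inj₁ (refl , _) with () ← trans (sym uncoloured) Pi₀j≡y
    ... | inj₂ (_ , at)    = trans at (extends i₀ j y Pi₀j≡y)

    x≡L : x ≡ L i₀ j₀
    x≡L = trans (sym (updateAt-updates j₀ (L i₀))) (row-determined i₀ ρ ρ-injective ρ-fresh ρ-extends j₀)

  swap-in-row : ∀ {i₀ j₁ j₂} → j₁ ≢ j₂ → P i₀ j₁ ≡ nothing → P i₀ j₂ ≡ nothing →
    InCol L j₁ (L i₀ j₂) ⊎ InCol L j₂ (L i₀ j₁)
  swap-in-row {i₀} {j₁} {j₂} j₁≢j₂ uncoloured₁ uncoloured₂
    with inCol? L j₁ (L i₀ j₂) | inCol? L j₂ (L i₀ j₁)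
  ... | yes ∈col₁ | _        = inj₁ ∈col₁
  ... | no _      | yes ∈col₂ = inj₂ ∈col₂
  ... | no ∉col₁  | no ∉col₂  =
    contradiction (trans (cong (L i₀) (sym (transpose-matchˡ j₁ j₂))) (row-determined i₀ ρ ρ-injective ρ-fresh ρ-extends j₁))
                  (distinct-in-row latin (≢-sym j₁≢j₂))
    where
    ρ : Fin n → Fin k
    ρ = L i₀ ∘ transpose j₁ j₂

    ρ-injective : ∀ {j j′} → ρ j ≡ ρ j′ → j ≡ j′
    ρ-injective = transpose-injective j₁ j₂ ∘ proj₁ latin i₀ _ _

    ρ-fresh : ∀ i j → i ≢ i₀ → L i j ≢ ρ j
    ρ-fresh i j i≢i₀ eq with transpose-cases j₁ j₂ j
    ... | inj₁ (refl , τj)         = ∉col₁ (i , trans eq (cong (L i₀) τj))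
    ... | inj₂ (inj₁ (refl , τj)) = ∉col₂ (i , trans eq (cong (L i₀) τj))
    ... | inj₂ (inj₂ τj)          = i≢i₀ (proj₂ latin i i₀ j (trans eq (cong (L i₀) τj)))

    ρ-extends : ∀ j y → P i₀ j ≡ just y → ρ j ≡ y
    ρ-extends j y Pi₀j≡y with transpose-cases j₁ j₂ j
    ... | inj₁ (refl , _)         with () ← trans (sym uncoloured₁) Pi₀j≡y
    ... | inj₂ (inj₁ (refl , _)) with () ← trans (sym uncoloured₂) Pi₀j≡y
    ... | inj₂ (inj₂ τj)          = trans (cong (L i₀) τj) (extends i₀ j y Pi₀j≡y)

record Tight {n k} (L : Coloring n k) (i j : Fin n) : Set where
  field
    cover          : ∀ x → InRow L i x ⊎ InCol L j x
    partner-unique : ∀ {x y} → Partner L i j x → Partner L i j y → x ≡ y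

  inCol-unless-inRow : ∀ {x} → ¬ InRow L i x → InCol L j x
  inCol-unless-inRow {x} ∉row = [ flip contradiction ∉row , id ]′ (cover x)

tight-flip : ∀ {n k} {L : Coloring n k} {i j} → Tight L i j → Tight (flip L) j i
tight-flip {L = L} t = record
  { cover          = ⊎-swap ∘ Tight.cover t
  ; partner-unique = λ p q → Tight.partner-unique t (partner-flip (flip L) p) (partner-flip (flip L) q)
  }

-- The unique extension around uncoloured entries (0,0) (0,1) (1,1) (1,2) (2,2) of the
-- block with rows r₀ r₁ r₂ and columns c₀ c₁ c₂: each swap field says that exchanging
-- the colours of two consecutive ones does not give another L(n,k).
record Staircase {n k} (L : Coloring n k) (r₀ r₁ r₂ c₀ c₁ c₂ : Fin n) : Set where
  field
    latin   : IsL n k L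
    r₀≢r₁   : r₀ ≢ r₁
    r₀≢r₂   : r₀ ≢ r₂
    r₁≢r₂   : r₁ ≢ r₂
    c₀≢c₁   : c₀ ≢ c₁
    c₀≢c₂   : c₀ ≢ c₂
    c₁≢c₂   : c₁ ≢ c₂
    tight₀₀ : Tight L r₀ c₀
    tight₀₁ : Tight L r₀ c₁
    tight₁₁ : Tight L r₁ c₁
    tight₁₂ : Tight L r₁ c₂
    tight₂₂ : Tight L r₂ c₂
    row-swap₀ : InCol L c₀ (L r₀ c₁) ⊎ InCol L c₁ (L r₀ c₀)
    col-swap₁ : InRow L r₀ (L r₁ c₁) ⊎ InRow L r₁ (L r₀ c₁)
    row-swap₁ : InCol L c₁ (L r₁ c₂) ⊎ InCol L c₂ (L r₁ c₁)
    col-swap₂ : InRow L r₁ (L r₂ c₂) ⊎ InRow L r₂ (L r₁ c₂)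

-- Reflection in the anti-diagonal of the 3 × 3 block maps the staircase to itself.
mirror : ∀ {n k} {L : Coloring n k} {r₀ r₁ r₂ c₀ c₁ c₂} →
  Staircase L r₀ r₁ r₂ c₀ c₁ c₂ → Staircase (flip L) c₂ c₁ c₀ r₂ r₁ r₀
mirror S = record
  { latin     = isL-flip latin
  ; r₀≢r₁     = ≢-sym c₁≢c₂
  ; r₀≢r₂     = ≢-sym c₀≢c₂
  ; r₁≢r₂     = ≢-sym c₀≢c₁
  ; c₀≢c₁     = ≢-sym r₁≢r₂
  ; c₀≢c₂     = ≢-sym r₀≢r₂
  ; c₁≢c₂     = ≢-sym r₀≢r₁
  ; tight₀₀   = tight-flip tight₂₂
  ; tight₀₁   = tight-flip tight₁₂
  ; tight₁₁   = tight-flip tight₁₁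
  ; tight₁₂   = tight-flip tight₀₁
  ; tight₂₂   = tight-flip tight₀₀
  ; row-swap₀ = ⊎-swap col-swap₂
  ; col-swap₁ = ⊎-swap row-swap₁
  ; row-swap₁ = ⊎-swap col-swap₁
  ; col-swap₂ = ⊎-swap row-swap₀
  }
  where open Staircase S

module Entries {n k} {L : Coloring n k} {r₀ r₁ r₂ c₀ c₁ c₂ : Fin n}
               (S : Staircase L r₀ r₁ r₂ c₀ c₁ c₂) where
  open Staircase S
  open Tight

  -- In proof terms a … i name the entries of the block row by row, and a variable
  -- such as b₀₀ proves that b is a partner at (0,0).

  row-≢ : ∀ {i j j′} → j ≢ j′ → L i j ≢ L i j′
  row-≢ = distinct-in-row latin

  col-≢ : ∀ {i i′ j} → i ≢ i′ → L i j ≢ L i′ j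
  col-≢ = distinct-in-col latin

  row-swap₀-partner : Partner L r₀ c₀ (L r₀ c₁) ⊎ Partner L r₀ c₁ (L r₀ c₀)
  row-swap₀-partner = ⊎-map (λ ∈col → (c₁ , refl) , ∈col , row-≢ (≢-sym c₀≢c₁))
                            (λ ∈col → (c₀ , refl) , ∈col , row-≢ c₀≢c₁) row-swap₀

  col-swap₁-partner : Partner L r₀ c₁ (L r₁ c₁) ⊎ Partner L r₁ c₁ (L r₀ c₁)
  col-swap₁-partner = ⊎-map (λ ∈row → ∈row , (r₁ , refl) , col-≢ (≢-sym r₀≢r₁))
                            (λ ∈row → ∈row , (r₀ , refl) , col-≢ r₀≢r₁) col-swap₁

  row-swap₁-partner : Partner L r₁ c₁ (L r₁ c₂) ⊎ Partner L r₁ c₂ (L r₁ c₁)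
  row-swap₁-partner = ⊎-map (λ ∈col → (c₂ , refl) , ∈col , row-≢ (≢-sym c₁≢c₂))
                            (λ ∈col → (c₁ , refl) , ∈col , row-≢ c₁≢c₂) row-swap₁

  col-swap₂-partner : Partner L r₁ c₂ (L r₂ c₂) ⊎ Partner L r₂ c₂ (L r₁ c₂)
  col-swap₂-partner = ⊎-map (λ ∈row → ∈row , (r₂ , refl) , col-≢ (≢-sym r₁≢r₂))
                            (λ ∈row → ∈row , (r₁ , refl) , col-≢ r₁≢r₂) col-swap₂

  entry₁₀-partner : Partner L r₀ c₀ (L r₁ c₀) ⊎ Partner L r₁ c₁ (L r₁ c₀)
  entry₁₀-partner with inRow? L r₀ (L r₁ c₀)
  ... | yes ∈row₀ = inj₁ (∈row₀ , (r₁ , refl) , col-≢ (≢-sym r₀≢r₁))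
  ... | no ∉row₀  = inj₂ ((c₀ , refl) , inCol-unless-inRow tight₀₁ ∉row₀ , row-≢ c₀≢c₁)

  entry₂₁-partner : Partner L r₁ c₁ (L r₂ c₁) ⊎ Partner L r₂ c₂ (L r₂ c₁)
  entry₂₁-partner with inRow? L r₁ (L r₂ c₁)
  ... | yes ∈row₁ = inj₁ (∈row₁ , (r₂ , refl) , col-≢ (≢-sym r₁≢r₂))
  ... | no ∉row₁  = inj₂ ((c₁ , refl) , inCol-unless-inRow tight₁₂ ∉row₁ , row-≢ c₁≢c₂)

  entry₀₂-partner : Partner L r₀ c₁ (L r₀ c₂) ⊎ Partner L r₁ c₂ (L r₀ c₂)
  entry₀₂-partner with inRow? L r₁ (L r₀ c₂)
  ... | yes ∈row₁ = inj₂ (∈row₁ , (r₀ , refl) , col-≢ r₀≢r₁)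
  ... | no ∉row₁  = inj₁ ((c₂ , refl) , inCol-unless-inRow tight₁₁ ∉row₁ , row-≢ (≢-sym c₁≢c₂))

  data Entry₂₀Placement : Set where
    partner₀₀ : Partner L r₀ c₀ (L r₂ c₀) → Entry₂₀Placement
    partner₁₁ : Partner L r₁ c₁ (L r₂ c₀) → Entry₂₀Placement
    partner₂₂ : Partner L r₂ c₂ (L r₂ c₀) → Entry₂₀Placement
    equals₁₁  : ¬ InRow L r₀ (L r₂ c₀) → L r₂ c₀ ≡ L r₁ c₁ → Entry₂₀Placement

  entry₂₀-placement : Entry₂₀Placement
  entry₂₀-placement with inRow? L r₀ (L r₂ c₀) | inRow? L r₁ (L r₂ c₀) | L r₂ c₀ ≟ L r₁ c₁
  ... | yes ∈row₀ | _         | _      = partner₀₀ (∈row₀ , (r₂ , refl) , col-≢ (≢-sym r₀≢r₂))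
  ... | no ∉row₀  | _         | yes ≡e = equals₁₁ ∉row₀ ≡e
  ... | no ∉row₀  | yes ∈row₁ | no ≢e  = partner₁₁ (∈row₁ , inCol-unless-inRow tight₀₁ ∉row₀ , ≢e)
  ... | no _      | no ∉row₁  | _      =
    partner₂₂ ((c₀ , refl) , inCol-unless-inRow tight₁₂ ∉row₁ , row-≢ c₀≢c₂)

  entry₀₁-not-partner₀₀-and-₁₁ : Partner L r₀ c₀ (L r₀ c₁) → Partner L r₁ c₁ (L r₀ c₁) → ⊥
  entry₀₁-not-partner₀₀-and-₁₁ b₀₀ b₁₁ = placeEntry₂₀ entry₂₀-placement
    where
    d≡b : L r₁ c₀ ≡ L r₀ c₁
    d≡b = [ (λ d₀₀ → partner-unique tight₀₀ d₀₀ b₀₀) , (λ d₁₁ → partner-unique tight₁₁ d₁₁ b₁₁) ]′ entry₁₀-partner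

    g≢b : L r₂ c₀ ≢ L r₀ c₁
    g≢b g≡b = col-≢ (≢-sym r₁≢r₂) (trans g≡b (sym d≡b))

    h₂₂ : Partner L r₂ c₂ (L r₂ c₁)
    h₂₂ = [ (λ h₁₁ → ⊥-elim (col-≢ (≢-sym r₀≢r₂) (partner-unique tight₁₁ h₁₁ b₁₁))) , id ]′ entry₂₁-partner

    placeEntry₂₀ : Entry₂₀Placement → ⊥
    placeEntry₂₀ (partner₀₀ g₀₀)  = g≢b (partner-unique tight₀₀ g₀₀ b₀₀)
    placeEntry₂₀ (partner₁₁ g₁₁)  = g≢b (partner-unique tight₁₁ g₁₁ b₁₁)
    placeEntry₂₀ (partner₂₂ g₂₂)  = row-≢ c₀≢c₁ (partner-unique tight₂₂ g₂₂ h₂₂)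
    placeEntry₂₀ (equals₁₁ _ g≡e) with row-swap₁-partner
    ... | inj₁ f₁₁ = row-≢ (≢-sym c₀≢c₂) (trans (partner-unique tight₁₁ f₁₁ b₁₁) (sym d≡b))
    ... | inj₂ (_ , ∈col₂ , _) =
      col-≢ r₁≢r₂ (partner-unique tight₂₂ ((c₀ , g≡e) , ∈col₂ , row-≢ c₀≢c₂ ∘ trans g≡e) h₂₂)

  entry₁₀-partner₁₁ : Partner L r₀ c₀ (L r₀ c₁) → Partner L r₁ c₁ (L r₁ c₀)
  entry₁₀-partner₁₁ b₀₀ with entry₁₀-partner
  ... | inj₂ d₁₁ = d₁₁
  ... | inj₁ d₀₀ = ⊥-elim (entry₀₁-not-partner₀₀-and-₁₁ b₀₀
                      (subst (InRow L r₁) (partner-unique tight₀₀ d₀₀ b₀₀) (c₀ , refl) , (r₀ , refl) , col-≢ r₀≢r₁))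

  entry₂₀≢entry₀₁ : Partner L r₀ c₀ (L r₀ c₁) → Partner L r₂ c₂ (L r₁ c₂) → L r₂ c₀ ≢ L r₀ c₁
  entry₂₀≢entry₀₁ b₀₀ f₂₂ g≡b with inRow? L r₁ (L r₀ c₁)
  ... | yes ∈row₁ = entry₀₁-not-partner₀₀-and-₁₁ b₀₀ (∈row₁ , (r₀ , refl) , col-≢ r₀≢r₁)
  ... | no ∉row₁  = ∉row₁ (subst (InRow L r₁) (sym (partner-unique tight₂₂ b₂₂ f₂₂)) (c₂ , refl))
    where
    b₂₂ : Partner L r₂ c₂ (L r₀ c₁)
    b₂₂ = (c₀ , g≡b) , inCol-unless-inRow tight₁₂ ∉row₁ , row-≢ c₀≢c₂ ∘ trans g≡b

module Core {n k} {L : Coloring n k} {r₀ r₁ r₂ c₀ c₁ c₂ : Fin n}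
            (S : Staircase L r₀ r₁ r₂ c₀ c₁ c₂) where
  open Staircase S
  open Entries S
  open Tight
  private module Mirrored = Entries (mirror S)

  entry₂₀≢entry₁₂ : Partner L r₀ c₀ (L r₀ c₁) → Partner L r₂ c₂ (L r₁ c₂) → L r₂ c₀ ≢ L r₁ c₂
  entry₂₀≢entry₁₂ b₀₀ f₂₂ = Mirrored.entry₂₀≢entry₀₁ (partner-flip L f₂₂) (partner-flip L b₀₀)

  entries₀₁-₁₂-not-partners₀₀-₂₂ :
    InRow L r₀ (L r₁ c₁) → Partner L r₀ c₀ (L r₀ c₁) → Partner L r₂ c₂ (L r₁ c₂) → ⊥
  entries₀₁-₁₂-not-partners₀₀-₂₂ e∈row₀ b₀₀ f₂₂ with entry₂₀-placement
  ... | partner₀₀ g₀₀       = entry₂₀≢entry₀₁ b₀₀ f₂₂ (partner-unique tight₀₀ g₀₀ b₀₀)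
  ... | partner₁₁ g₁₁       = col-≢ (≢-sym r₁≢r₂) (partner-unique tight₁₁ g₁₁ (entry₁₀-partner₁₁ b₀₀))
  ... | partner₂₂ g₂₂       = entry₂₀≢entry₁₂ b₀₀ f₂₂ (partner-unique tight₂₂ g₂₂ f₂₂)
  ... | equals₁₁ ∉row₀ g≡e = ∉row₀ (subst (InRow L r₀) (sym g≡e) e∈row₀)

  entry₀₂-not-partner₀₁ : Partner L r₀ c₁ (L r₀ c₂) → ⊥
  entry₀₂-not-partner₀₁ c₀₁ = [ entry₁₁-not-partner₀₁ , entry₀₁-not-partner₀₀-and-₁₁ b₀₀ ]′ col-swap₁-partner
    where
    b₀₀ : Partner L r₀ c₀ (L r₀ c₁)
    b₀₀ = [ id , (λ a₀₁ → ⊥-elim (row-≢ c₀≢c₂ (partner-unique tight₀₁ a₀₁ c₀₁))) ]′ row-swap₀-partner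

    entry₁₁-not-partner₀₁ : Partner L r₀ c₁ (L r₁ c₁) → ⊥
    entry₁₁-not-partner₀₁ e₀₁ = [ i₁₂-impossible , entries₀₁-₁₂-not-partners₀₀-₂₂ (proj₁ e₀₁) b₀₀ ]′ col-swap₂-partner
      where
      e≡c : L r₁ c₁ ≡ L r₀ c₂
      e≡c = partner-unique tight₀₁ e₀₁ c₀₁

      i₁₂-impossible : Partner L r₁ c₂ (L r₂ c₂) → ⊥
      i₁₂-impossible i₁₂ =
        col-≢ (≢-sym r₀≢r₂) (trans (partner-unique tight₁₂ i₁₂ ((c₁ , refl) , (r₀ , sym e≡c) , row-≢ c₁≢c₂)) e≡c)

staircase-impossible : ∀ {n k} {L : Coloring n k} {r₀ r₁ r₂ c₀ c₁ c₂} → Staircase L r₀ r₁ r₂ c₀ c₁ c₂ → ⊥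
staircase-impossible {L = L} S =
  [ Core.entry₀₂-not-partner₀₁ S , Core.entry₀₂-not-partner₀₁ (mirror S) ∘ partner-flip L ]′ (Entries.entry₀₂-partner S)

no-staircase : ∀ {n k} {P : PartialColoring n k} → UniquelyExtends n k P → n + n < k + 3 →
  ∀ {r₀ r₁ r₂ c₀ c₁ c₂} → Distinct₃ r₀ r₁ r₂ → Distinct₃ c₀ c₁ c₂ →
  P r₀ c₀ ≡ nothing → P r₀ c₁ ≡ nothing → P r₁ c₁ ≡ nothing → P r₁ c₂ ≡ nothing → P r₂ c₂ ≡ nothing → ⊥
no-staircase {P = P} U n+n<k+3 (r₀≢r₁ , r₀≢r₂ , r₁≢r₂) (c₀≢c₁ , c₀≢c₂ , c₁≢c₂) u₀₀ u₀₁ u₁₁ u₁₂ u₂₂ =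
  staircase-impossible record
    { latin     = latin
    ; r₀≢r₁     = r₀≢r₁
    ; r₀≢r₂     = r₀≢r₂
    ; r₁≢r₂     = r₁≢r₂
    ; c₀≢c₁     = c₀≢c₁
    ; c₀≢c₂     = c₀≢c₂
    ; c₁≢c₂     = c₁≢c₂
    ; tight₀₀   = tight u₀₀
    ; tight₀₁   = tight u₀₁
    ; tight₁₁   = tight u₁₁
    ; tight₁₂   = tight u₁₂
    ; tight₂₂   = tight u₂₂
    ; row-swap₀ = swap-in-row c₀≢c₁ u₀₀ u₀₁
    ; col-swap₁ = Flipped.swap-in-row r₀≢r₁ u₀₁ u₁₁
    ; row-swap₁ = swap-in-row c₁≢c₂ u₁₁ u₁₂
    ; col-swap₂ = Flipped.swap-in-row r₁≢r₂ u₁₂ u₂₂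
    }
  where
  open UniqueExtension U
  module Flipped = UniqueExtension (uniquelyExtends-flip U)

  tight : ∀ {i j} → P i j ≡ nothing → Tight L i j
  tight uncoloured = record
    { cover          = cover uncoloured
    ; partner-unique = at-most-one-partner {L = L} n+n<k+3 (cover uncoloured)
    }

lemma4 : (n : ℕ) → 3 ≤ n → (P : PartialColoring n (2 * n ∸ 2)) →
    UniquelyExtends n (2 * n ∸ 2) P →
    (∀ r c (r0 : r < n) (r1 : r + 1 < n) (r2 : r + 2 < n)
           (c0 : c < n) (c1 : c + 1 < n) (c2 : c + 2 < n) →
       ¬ (Uncolored P r c r0 c0 × Uncolored P r (c + 1) r0 c1 ×
          Uncolored P (r + 1) (c + 1) r1 c1 × Uncolored P (r + 1) (c + 2) r1 c2 ×
          Uncolored P (r + 2) (c + 2) r2 c2)) ×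
    (∀ r c (r0 : r < n) (r1 : r + 1 < n) (r2 : r + 2 < n)
           (c0 : c < n) (c1 : c + 1 < n) (c2 : c + 2 < n) →
       ¬ (Uncolored P r c r0 c0 × Uncolored P (r + 1) c r1 c0 ×
          Uncolored P (r + 1) (c + 1) r1 c1 × Uncolored P (r + 2) (c + 1) r2 c1 ×
          Uncolored P (r + 2) (c + 2) r2 c2))
lemma4 n _ P U =
  (λ r c r0 r1 r2 c0 c1 c2 (u₀₀ , u₀₁ , u₁₁ , u₁₂ , u₂₂) →
     no-staircase U (n+n<2n∸2+3 n) (consecutive-distinct r r0 r1 r2) (consecutive-distinct c c0 c1 c2)
       u₀₀ u₀₁ u₁₁ u₁₂ u₂₂) ,
  (λ r c r0 r1 r2 c0 c1 c2 (u₀₀ , u₁₀ , u₁₁ , u₂₁ , u₂₂) →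
     no-staircase (uniquelyExtends-flip U) (n+n<2n∸2+3 n) (consecutive-distinct c c0 c1 c2) (consecutive-distinct r r0 r1 r2)
       u₀₀ u₁₀ u₁₁ u₂₁ u₂₂)
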